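{- A finite semidistributive lattice with $k$ atoms has order dimension at least $k$.
   Context: A lattice is join semidistributive if $p\vee q=p\vee r$ implies $p\vee q=p\vee(q\wedge r)$ for all $p,q,r$; meet semidistributive if the dual condition holds ($p\wedge q=p\wedge r$ implies $p\wedge q=p\wedge(q\vee r)$); semidistributive if both. Atoms are the elements covering the bottom element. The order dimension of a finite poset is the least $d$ such that its order relation is the intersection of $d$ linear extensions. -}

module Defs where

open import Level using (0ℓ)
open import Data.Nat using (ℕ)
open import Data.Fin using (Fin)
open import Data.Product using (Σ; ∃; _×_)
open import Data.Sum using (_⊎_)
open import Relation.Nullary using (¬_)
open import Relation.Binary.Core using (Rel; _⇒_)
open import Relation.Binary.Definitions using (Total)
open import Relation.Binary.Structures using (IsTotalOrder)
open import Relation.Binary.PropositionalEquality using (_≡_)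
open import Relation.Binary.Lattice.Structures using (IsLattice)
open import Function.Definitions using (Injective)

record FiniteLattice : Set₁ where
  field
    n         : ℕ
    _≤_       : Rel (Fin n) 0ℓ
    _∨_       : Fin n → Fin n → Fin n
    _∧_       : Fin n → Fin n → Fin n
    isLattice : IsLattice _≡_ _≤_ _∨_ _∧_

module _ (L : FiniteLattice) where
  open FiniteLattice L

  JoinSemidistributive : Set
  JoinSemidistributive = ∀ p q r → p ∨ q ≡ p ∨ r → p ∨ q ≡ p ∨ (q ∧ r)

  MeetSemidistributive : Set
  MeetSemidistributive = ∀ p q r → p ∧ q ≡ p ∧ r → p ∧ q ≡ p ∧ (q ∨ r)

  Semidistributive : Set
  Semidistributive = JoinSemidistributive × MeetSemidistributive

  IsBottom : Fin n → Set
  IsBottom b = ∀ y → b ≤ y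

  Covers : Fin n → Fin n → Set
  Covers x b = (b ≤ x) × ¬ (b ≡ x) × (∀ z → b ≤ z → z ≤ x → (z ≡ b) ⊎ (z ≡ x))

  IsAtom : Fin n → Set
  IsAtom x = Σ (Fin n) λ b → IsBottom b × Covers x b

  HasExactlyAtoms : ℕ → Set
  HasExactlyAtoms k = Σ (Fin k → Fin n) λ a →
    Injective _≡_ _≡_ a × (∀ i → IsAtom (a i)) × (∀ x → IsAtom x → ∃ λ i → a i ≡ x)

  IsLinearExtension : Rel (Fin n) 0ℓ → Set
  IsLinearExtension R = IsTotalOrder _≡_ R × (_≤_ ⇒ R)

  -- _≤_ is the intersection of the d linear extensions R
  IsRealizer : (d : ℕ) → (Fin d → Rel (Fin n) 0ℓ) → Set
  IsRealizer d R = (∀ i → IsLinearExtension (R i)) ×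
                   (∀ x y → (∀ i → R i x y) → x ≤ y)

  DimensionAtLeast : ℕ → Set₁
  DimensionAtLeast k = ∀ d (R : Fin d → Rel (Fin n) 0ℓ) → IsRealizer d R → k Data.Nat.≤ d

-- Let a₀, …, a_{k-1} be the atoms and yᵢ the join of all atoms other than aᵢ.
-- Distinct atoms meet in ⊥, so by meet semidistributivity aᵢ ∧ yᵢ = ⊥ and
-- hence aᵢ ≰ yᵢ, while aⱼ ≤ yᵢ for j ≠ i: the pairs (aᵢ, yᵢ) form a standard
-- example Sₖ. Every linear extension reversing some pair (aᵢ, yᵢ) reverses
-- no other one, so a realizer needs a distinct extension for each i.
module Submission where

open import Defs
open import Data.Nat using (ℕ; zero; suc; z≤n)
open import Data.Fin using (Fin; zero; suc; punchIn; punchOut)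
open import Data.Fin.Properties
  using (_≟_; ¬∀⟶∃¬; injective⇒≤; punchIn-punchOut; punchInᵢ≢i)
open import Data.Vec.Functional using (foldr)
open import Data.Product using (∃; _,_; proj₁; proj₂)
open import Data.Sum using (inj₁; inj₂)
open import Data.Empty using (⊥-elim)
open import Function using (_∘_)
open import Relation.Nullary using (¬_; yes; no)
open import Relation.Binary.Consequences using (total∧dec⇒dec)
open import Relation.Binary.PropositionalEquality
  using (_≡_; _≢_; sym; trans; cong; subst)
open import Relation.Binary.Lattice.Structures using (IsLattice)
open import Relation.Binary.Structures using (IsTotalOrder)
open import Function.Definitions using (Injective)

module _ (L : FiniteLattice) where
  open FiniteLattice L
  open IsLattice isLattice
    using (antisym; x≤x∨y; y≤x∨y; x∧y≤x; x∧y≤y; ∧-greatest)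
    renaming (trans to ≤-trans)

  standardExample⇒dimension≥ : ∀ {k} (x y : Fin k → Fin n) →
    (∀ {i j} → i ≢ j → x j ≤ y i) → (∀ i → ¬ x i ≤ y i) →
    DimensionAtLeast L k
  standardExample⇒dimension≥ x y x≤y x≰y d R (extension , realizes) =
    injective⇒≤ reversing-injective
    where
    module R l = IsTotalOrder (proj₁ (extension l))

    reversing : ∀ i → ∃ λ l → ¬ R l (x i) (y i)
    reversing i = ¬∀⟶∃¬ d _
      (λ l → total∧dec⇒dec (R.reflexive l) (R.antisym l) (R.total l) _≟_ (x i) (y i))
      (x≰y i ∘ realizes (x i) (y i))

    reversed : ∀ i → R (proj₁ (reversing i)) (y i) (x i)
    reversed i with R.total (proj₁ (reversing i)) (x i) (y i)
    ... | inj₁ xRy = ⊥-elim (proj₂ (reversing i) xRy)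
    ... | inj₂ yRx = yRx

    reversing-injective : Injective _≡_ _≡_ (proj₁ ∘ reversing)
    reversing-injective {i} {j} same with i ≟ j
    ... | yes i≡j = i≡j
    ... | no  i≢j = ⊥-elim (proj₂ (reversing j) xⱼRyⱼ)
      where
      l : Fin d
      l = proj₁ (reversing j)
      lift : ∀ {u v} → u ≤ v → R l u v
      lift = proj₂ (extension l)
      xⱼRyⱼ : R l (x j) (y j)
      xⱼRyⱼ = R.trans l (lift (x≤y i≢j))
                (R.trans l (subst (λ m → R m (y i) (x i)) same (reversed i))
                           (lift (x≤y (i≢j ∘ sym))))

  ⋁ : ∀ {m} → Fin n → (Fin m → Fin n) → Fin n
  ⋁ base = foldr _∨_ base

  ⋁-upperBound : ∀ {m} base (f : Fin m → Fin n) j → f j ≤ ⋁ base f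
  ⋁-upperBound base f zero    = x≤x∨y _ _
  ⋁-upperBound base f (suc j) = ≤-trans (⋁-upperBound base (f ∘ suc) j) (y≤x∨y _ _)

  meetSemidistributive-⋁ : MeetSemidistributive L →
    ∀ {x c base m} (f : Fin m → Fin n) →
    x ∧ base ≡ c → (∀ j → x ∧ f j ≡ c) → x ∧ ⋁ base f ≡ c
  meetSemidistributive-⋁ msd {m = zero}  f x∧base x∧f = x∧base
  meetSemidistributive-⋁ msd {x} {c} {base} {suc m} f x∧base x∧f =
    trans (sym (msd _ _ _ (trans (x∧f zero) (sym x∧rest)))) (x∧f zero)
    where
    x∧rest : x ∧ ⋁ base (f ∘ suc) ≡ c
    x∧rest = meetSemidistributive-⋁ msd (f ∘ suc) x∧base (x∧f ∘ suc)

  bottom-unique : ∀ {b b′} → IsBottom L b → IsBottom L b′ → b ≡ b′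
  bottom-unique b≤ b′≤ = antisym (b≤ _) (b′≤ _)

  x∧bottom≡bottom : ∀ {b} x → IsBottom L b → x ∧ b ≡ b
  x∧bottom≡bottom x b≤ = antisym (x∧y≤y _ _) (∧-greatest (b≤ x) (b≤ _))

  atom-covers-bottom : ∀ {b x} → IsBottom L b → IsAtom L x → Covers L x b
  atom-covers-bottom b≤ (b′ , b′≤ , covers) =
    subst (Covers L _) (bottom-unique b′≤ b≤) covers

  atom∧atom≡bottom : ∀ {b x y} → IsBottom L b → IsAtom L x → IsAtom L y →
    x ≢ y → x ∧ y ≡ b
  atom∧atom≡bottom {b} {x} {y} b≤ atom-x atom-y x≢y
    with proj₂ (proj₂ (atom-covers-bottom b≤ atom-x)) (x ∧ y) (b≤ _) (x∧y≤x _ _)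
  ... | inj₁ x∧y≡b = x∧y≡b
  ... | inj₂ x∧y≡x
    with proj₂ (proj₂ (atom-covers-bottom b≤ atom-y)) x (b≤ x)
           (subst (_≤ y) x∧y≡x (x∧y≤y _ _))
  ...   | inj₁ x≡b = ⊥-elim (proj₁ (proj₂ (atom-covers-bottom b≤ atom-x)) (sym x≡b))
  ...   | inj₂ x≡y = ⊥-elim (x≢y x≡y)

  atom≰⋁-otherAtoms : MeetSemidistributive L → ∀ {b x m} → IsBottom L b →
    IsAtom L x → (f : Fin m → Fin n) → (∀ j → IsAtom L (f j)) →
    (∀ j → x ≢ f j) → ¬ x ≤ ⋁ b f
  atom≰⋁-otherAtoms msd {b} {x} b≤ atom-x f atom-f x≢f x≤⋁ =
    proj₁ (proj₂ (atom-covers-bottom b≤ atom-x)) (antisym (b≤ x) x≤b)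
    where
    x∧⋁≡b : x ∧ ⋁ b f ≡ b
    x∧⋁≡b = meetSemidistributive-⋁ msd f (x∧bottom≡bottom x b≤)
              (λ j → atom∧atom≡bottom b≤ atom-x (atom-f j) (x≢f j))
    x≤b : x ≤ b
    x≤b = subst (x ≤_) x∧⋁≡b (∧-greatest (IsLattice.refl isLattice) x≤⋁)

lemma4p22 : (L : FiniteLattice) (k : ℕ) → Semidistributive L → HasExactlyAtoms L k →
    DimensionAtLeast L k
lemma4p22 L zero    _         _                           _ _ _ = z≤n
lemma4p22 L (suc k) (_ , msd) (a , a-injective , a-atom , _) =
  standardExample⇒dimension≥ L a otherAtoms a≤otherAtoms a≰otherAtoms
  where
  open FiniteLattice L using (_≤_)

  b : Fin (FiniteLattice.n L)
  b = proj₁ (a-atom zero)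
  b≤ : IsBottom L b
  b≤ = proj₁ (proj₂ (a-atom zero))

  otherAtoms : Fin (suc k) → Fin (FiniteLattice.n L)
  otherAtoms i = ⋁ L b (a ∘ punchIn i)

  a≤otherAtoms : ∀ {i j} → i ≢ j → a j ≤ otherAtoms i
  a≤otherAtoms {i} i≢j = subst (_≤ otherAtoms i) (cong a (punchIn-punchOut i≢j))
    (⋁-upperBound L b (a ∘ punchIn i) (punchOut i≢j))

  a≰otherAtoms : ∀ i → ¬ a i ≤ otherAtoms i
  a≰otherAtoms i = atom≰⋁-otherAtoms L msd b≤ (a-atom i) (a ∘ punchIn i)
    (a-atom ∘ punchIn i) (λ j → punchInᵢ≢i i j ∘ sym ∘ a-injective)
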